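{- Let $\overline F\colon\mathbf{PMet}\to\mathbf{PMet}$ be a lifting of a functor $F\colon\mathbf{Set}\to\mathbf{Set}$. If $d_1\le d_2$ are two pseudometrics on the same set $X$, then $d_1^F\le d_2^F$ on $FX$.
   Context: Fix $\top\in(0,\infty]$; pseudometrics take values in $[0,\top]$. $\mathbf{PMet}$ is the category of pseudometric spaces and nonexpansive maps; $U\colon\mathbf{PMet}\to\mathbf{Set}$ the forgetful functor. A lifting of $F$ is a functor $\overline F$ with $U\circ\overline F=F\circ U$; for a pseudometric space $(X,d)$, $d^F$ denotes the pseudometric on $FX$ with $\overline F(X,d)=(FX,d^F)$. The order on pseudometrics is pointwise. -}

module Defs where

open import Level using (0ℓ)
open import Data.Product using (Σ; _×_; ∃)
open import Data.Empty using (⊥)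
open import Relation.Nullary using (¬_)
open import Relation.Binary.PropositionalEquality using (_≡_)
open import Algebra.Structures using (IsCommutativeRing)
open import Relation.Binary.Structures using (IsTotalOrder)

-- The real numbers, axiomatised as a (Dedekind-)complete ordered field.
-- (agda-stdlib has no reals; any model of this record is isomorphic to ℝ.)

record RealNumbers : Set₁ where
  infix  4 _≈_ _≤_
  infixl 6 _+_
  infixl 7 _*_
  field
    ℝ   : Set
    _≈_ : ℝ → ℝ → Set
    _+_ : ℝ → ℝ → ℝ
    _*_ : ℝ → ℝ → ℝ
    -_  : ℝ → ℝ
    0ℝ  : ℝ
    1ℝ  : ℝ
    _≤_ : ℝ → ℝ → Set
    isCommutativeRing : IsCommutativeRing _≈_ _+_ _*_ -_ 0ℝ 1ℝ
    0≉1 : ¬ (0ℝ ≈ 1ℝ)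
    inverse : ∀ x → ¬ (x ≈ 0ℝ) → Σ ℝ (λ y → x * y ≈ 1ℝ)
    isTotalOrder : IsTotalOrder _≈_ _≤_
    +-mono-≤ : ∀ {x y} z → x ≤ y → x + z ≤ y + z
    *-nonneg : ∀ {x y} → 0ℝ ≤ x → 0ℝ ≤ y → 0ℝ ≤ x * y
    sup : (S : ℝ → Set) → ∃ S → (∃ λ b → ∀ x → S x → x ≤ b) →
          Σ ℝ (λ s → (∀ x → S x → x ≤ s) × (∀ b → (∀ x → S x → x ≤ b) → s ≤ b))

  _<_ : ℝ → ℝ → Set
  x < y = (x ≤ y) × ¬ (x ≈ y)

module Extended (R : RealNumbers) where
  open RealNumbers R

  data ℝ∞ : Set where
    fin : ℝ → ℝ∞
    ∞   : ℝ∞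

  infix 4 _≤∞_ _<∞_
  data _≤∞_ : ℝ∞ → ℝ∞ → Set where
    fin≤fin : ∀ {x y} → x ≤ y → fin x ≤∞ fin y
    _≤∞∞    : ∀ x → x ≤∞ ∞

  data _<∞_ : ℝ∞ → ℝ∞ → Set where
    fin<fin : ∀ {x y} → x < y → fin x <∞ fin y
    fin<∞   : ∀ x → fin x <∞ ∞

  infixl 6 _+∞_
  _+∞_ : ℝ∞ → ℝ∞ → ℝ∞
  fin x +∞ fin y = fin (x + y)
  fin x +∞ ∞     = ∞
  ∞     +∞ _     = ∞

  data _≈∞_ : ℝ∞ → ℝ∞ → Set where
    fin≈fin : ∀ {x y} → x ≈ y → fin x ≈∞ fin y
    ∞≈∞     : ∞ ≈∞ ∞

  module WithTop (⊤ : ℝ∞) (0<⊤ : fin 0ℝ <∞ ⊤) where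

    record IsPseudometric (X : Set) (d : X → X → ℝ∞) : Set where
      field
        nonneg   : ∀ x y → fin 0ℝ ≤∞ d x y
        bounded  : ∀ x y → d x y ≤∞ ⊤
        refl0    : ∀ x → d x x ≈∞ fin 0ℝ
        symmetric : ∀ x y → d x y ≈∞ d y x
        triangle : ∀ x y z → d x z ≤∞ d x y +∞ d y z

    record PMetSpace : Set₁ where
      field
        Carrier : Set
        dist    : Carrier → Carrier → ℝ∞
        isPseudometric : IsPseudometric Carrier dist
    open PMetSpace public

    Nonexpansive : (A B : PMetSpace) → (Carrier A → Carrier B) → Set
    Nonexpansive A B f = ∀ x y → dist B (f x) (f y) ≤∞ dist A x y

    _⊑_ : {X : Set} → (X → X → ℝ∞) → (X → X → ℝ∞) → Set
    d₁ ⊑ d₂ = ∀ x y → d₁ x y ≤∞ d₂ x y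

    record SetFunctor : Set₁ where
      field
        F₀ : Set → Set
        F₁ : {A B : Set} → (A → B) → F₀ A → F₀ B
        F-id : {A : Set} (u : F₀ A) → F₁ (λ (a : A) → a) u ≡ u
        F-∘  : {A B C : Set} (g : B → C) (f : A → B) (u : F₀ A) →
               F₁ (λ a → g (f a)) u ≡ F₁ g (F₁ f u)
    open SetFunctor public

    -- a lifting F̄ : PMet → PMet of F, i.e. U ∘ F̄ = F ∘ U. Since morphisms of
    -- PMet are maps with a property, F̄ is determined by its object part
    -- (X,d) ↦ (F X, d^F), subject to F f being nonexpansive whenever f is.
    record Lifting (F : SetFunctor) : Set₁ where
      field
        lift : (A : PMetSpace) → F₀ F (Carrier A) → F₀ F (Carrier A) → ℝ∞
        lift-pseudometric : (A : PMetSpace) → IsPseudometric (F₀ F (Carrier A)) (lift A)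
        lift-map : (A B : PMetSpace) (f : Carrier A → Carrier B) → Nonexpansive A B f →
                   ∀ u v → lift B (F₁ F f u) (F₁ F f v) ≤∞ lift A u v
    open Lifting public

    liftDist : {F : SetFunctor} → Lifting F → (X : Set) (d : X → X → ℝ∞) →
               IsPseudometric X d → F₀ F X → F₀ F X → ℝ∞
    liftDist L X d p = lift L (record { Carrier = X ; dist = d ; isPseudometric = p })

module Submission where

-- Idea: if d₁ ⊑ d₂ are pseudometrics on X, the identity of X is a
-- nonexpansive map (X, d₂) → (X, d₁) — nonexpansiveness of the identity is
-- literally the pointwise order. A lifting F̄ sends nonexpansive maps to
-- nonexpansive maps, so F id is nonexpansive (F X, d₂^F) → (F X, d₁^F).
-- Since F preserves identities, F id acts as the identity on F X, and
-- nonexpansiveness of the identity is again the pointwise order d₁^F ⊑ d₂^F.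

open import Defs
open import Relation.Binary.PropositionalEquality using (subst₂)

module _ (R : RealNumbers) where
  open Extended R

  module _ (⊤ : ℝ∞) (0<⊤ : fin (RealNumbers.0ℝ R) <∞ ⊤) where
    open WithTop ⊤ 0<⊤

    space : (X : Set) (d : X → X → ℝ∞) → IsPseudometric X d → PMetSpace
    space X d p = record { Carrier = X ; dist = d ; isPseudometric = p }

    liftPreservesIdentity : (F : SetFunctor) (F̄ : Lifting F) (X : Set)
      (d e : X → X → ℝ∞) (p : IsPseudometric X d) (q : IsPseudometric X e) →
      Nonexpansive (space X d p) (space X e q) (λ x → x) →
      Nonexpansive (space (F₀ F X) (liftDist F̄ X d p) (lift-pseudometric F̄ (space X d p)))
                   (space (F₀ F X) (liftDist F̄ X e q) (lift-pseudometric F̄ (space X e q)))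
                   (λ u → u)
    liftPreservesIdentity F F̄ X d e p q idNonexpansive u v =
      subst₂ (λ u′ v′ → liftDist F̄ X e q u′ v′ ≤∞ liftDist F̄ X d p u v)
             (F-id F u) (F-id F v)
             (lift-map F̄ (space X d p) (space X e q) (λ x → x) idNonexpansive u v)

propositionP3 : (R : RealNumbers) → let open Extended R in
    (⊤ : ℝ∞) (0<⊤ : fin (RealNumbers.0ℝ R) <∞ ⊤) → let open WithTop ⊤ 0<⊤ in
    (F : SetFunctor) (F̄ : Lifting F) (X : Set) (d₁ d₂ : X → X → ℝ∞)
    (p₁ : IsPseudometric X d₁) (p₂ : IsPseudometric X d₂) →
    d₁ ⊑ d₂ → liftDist F̄ X d₁ p₁ ⊑ liftDist F̄ X d₂ p₂
propositionP3 R ⊤ 0<⊤ F F̄ X d₁ d₂ p₁ p₂ d₁⊑d₂ =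
  liftPreservesIdentity R ⊤ 0<⊤ F F̄ X d₂ d₁ p₂ p₁ d₁⊑d₂
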